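{- Let $n$ be a positive integer and let $\mathcal{G}^2_n=(V,\{C_H,C_V\},R)$ be the multi-layer graph defined in the context. Then the cop player has a winning strategy with two cops if both cops are allocated to layer $C_H$, and also has a winning strategy with two cops if both cops are allocated to layer $C_V$.
   Context: A multi-layer graph with designated layers is $\mathcal{G}=(V,\{C_1,\dots,C_\tau\},R)$ with finite vertex set $V$, cop layers $C_i\subseteq\binom{V}{2}$ and robber layer $R\subseteq\binom{V}{2}$. Game with an allocation $(k_1,\dots,k_\tau)$: $k_i$ cops are assigned to $C_i$; cops are placed on vertices first, then the robber; turns alternate starting with the cops; on the cops' turn each cop stays or moves along one edge of its own layer; on the robber's turn it stays or moves along one edge of $R$; the cops win if some cop ever occupies the robber's vertex, the robber wins if it evades forever; perfect information. Definition of $\mathcal{G}^2_n$: $V=\{(i,j): i,j\in\{1,\dots,n\}\}$; $C_H=\{(i,j)(i,j+1): i\in[n], j\in[n-1]\}\cup\{(i,1)(i+1,1): i\in[n-1], i \text{ even}\}\cup\{(i,n)(i+1,n): i\in[n-1], i\text{ odd}\}$; $C_V=\{(i,j)(i+1,j): j\in[n], i\in[n-1]\}\cup\{(1,j)(1,j+1): j\in[n-1], j\text{ even}\}\cup\{(n,j)(n,j+1): j\in[n-1], j\text{ odd}\}$; $R=C_H\cup C_V$. -}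

module Defs where

open import Data.Nat using (ℕ; zero; suc; _∸_)
open import Data.Nat.Divisibility using (_∣_)
open import Data.Fin using (Fin; toℕ)
open import Data.Vec using (Vec; _∷_; []; head; lookup)
open import Data.Product using (Σ; _×_; _,_; proj₁; proj₂; ∃)
open import Data.Sum using (_⊎_)
open import Relation.Nullary using (¬_)
open import Relation.Binary.PropositionalEquality using (_≡_)

-- Multi-layer graphs with designated layers.
-- A layer (a set of unordered pairs {u,v}) is given by a relation E;
-- the pair {u,v} belongs to the layer iff  E u v  or  E v u.

record MultiLayerGraph : Set₁ where
  field
    V     : Set
    τ     : ℕ
    C     : Fin τ → V → V → Set
    R     : V → V → Set

InLayer : {V : Set} → (V → V → Set) → V → V → Set
InLayer E u v = E u v ⊎ E v u

Step : {V : Set} → (V → V → Set) → V → V → Set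
Step E u v = u ≡ v ⊎ InLayer E u v

module Game (G : MultiLayerGraph) (ks : Fin (MultiLayerGraph.τ G) → ℕ) where
  open MultiLayerGraph G

  Cop : Set
  Cop = Σ (Fin τ) (λ i → Fin (ks i))

  layerOf : Cop → Fin τ
  layerOf = proj₁

  CopPos : Set
  CopPos = Cop → V

  -- Histories are stored newest-first. After round t the history holds
  -- t+1 cop configurations and t+1 robber positions.  Strategies are
  -- arbitrary (history dependent, perfect information); legality of moves
  -- is built into their types.
  record CopStrategy : Set where
    field
      place : CopPos
      move  : ∀ {t} (cs : Vec CopPos (suc t)) (rs : Vec V (suc t)) →
              (c : Cop) → Σ V (Step (C (layerOf c)) (head cs c))

  record RobberStrategy : Set where
    field
      place : CopPos → V
      move  : ∀ {t} (cs : Vec CopPos (suc (suc t))) (rs : Vec V (suc t)) →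
              Σ V (Step R (head rs))

  history : CopStrategy → RobberStrategy → (t : ℕ) →
            Vec CopPos (suc t) × Vec V (suc t)
  history σ ρ zero =
    (CopStrategy.place σ ∷ []) , (RobberStrategy.place ρ (CopStrategy.place σ) ∷ [])
  history σ ρ (suc t) =
    let cs = proj₁ (history σ ρ t)
        rs = proj₂ (history σ ρ t)
        c' = λ c → proj₁ (CopStrategy.move σ cs rs c)
        r' = proj₁ (RobberStrategy.move ρ (c' ∷ cs) rs)
    in (c' ∷ cs) , (r' ∷ rs)

  copsAt : CopStrategy → RobberStrategy → ℕ → CopPos
  copsAt σ ρ t = head (proj₁ (history σ ρ t))

  robberAt : CopStrategy → RobberStrategy → ℕ → V
  robberAt σ ρ t = head (proj₂ (history σ ρ t))

  -- some cop occupies the robber's vertex at some moment: either at the end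
  -- of round t (after the robber's move / placement), or right after the
  -- cops' move in round t+1 (robber still at its round-t vertex).
  Captured : CopStrategy → RobberStrategy → Set
  Captured σ ρ = ∃ λ t → ∃ λ c →
    (copsAt σ ρ t c ≡ robberAt σ ρ t) ⊎ (copsAt σ ρ (suc t) c ≡ robberAt σ ρ t)

  CopsWin : Set
  CopsWin = Σ CopStrategy λ σ → (ρ : RobberStrategy) → Captured σ ρ

-- The multi-layer graph 𝒢²ₙ.  Vertex (a , b) : Fin n × Fin n stands for
-- (i , j) = (toℕ a + 1 , toℕ b + 1).

Vert : ℕ → Set
Vert n = Fin n × Fin n

Odd : ℕ → Set
Odd m = ¬ (2 ∣ m)

HBase : (n : ℕ) → Vert n → Vert n → Set
HBase n (a , b) (a' , b') =
    (a ≡ a' × toℕ b' ≡ suc (toℕ b))                                   -- (i,j)(i,j+1)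
  ⊎ ((toℕ b ≡ 0 × toℕ b' ≡ 0) × (toℕ a' ≡ suc (toℕ a) × 2 ∣ suc (toℕ a)))
                                                                     -- (i,1)(i+1,1), i even
  ⊎ ((suc (toℕ b) ≡ n × suc (toℕ b') ≡ n) × (toℕ a' ≡ suc (toℕ a) × Odd (suc (toℕ a))))
                                                                     -- (i,n)(i+1,n), i odd

VBase : (n : ℕ) → Vert n → Vert n → Set
VBase n (a , b) (a' , b') =
    (b ≡ b' × toℕ a' ≡ suc (toℕ a))                                   -- (i,j)(i+1,j)
  ⊎ ((toℕ a ≡ 0 × toℕ a' ≡ 0) × (toℕ b' ≡ suc (toℕ b) × 2 ∣ suc (toℕ b)))
                                                                     -- (1,j)(1,j+1), j even
  ⊎ ((suc (toℕ a) ≡ n × suc (toℕ a') ≡ n) × (toℕ b' ≡ suc (toℕ b) × Odd (suc (toℕ b))))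
                                                                     -- (n,j)(n,j+1), j odd

RBase : (n : ℕ) → Vert n → Vert n → Set
RBase n u v = HBase n u v ⊎ VBase n u v

-- layer index 0 is C_H, layer index 1 is C_V
G² : ℕ → MultiLayerGraph
G² n = record
  { V = Vert n
  ; τ = 2
  ; C = λ i → lookup (HBase n ∷ VBase n ∷ []) i
  ; R = RBase n
  }

alloc : ℕ → ℕ → Fin 2 → ℕ
alloc kH kV i = lookup (kH ∷ kV ∷ []) i

-- The cop layer C_H is a single Hamiltonian path through the n × n grid (the snake), while the robber
-- moves in the grid itself.  Call a cop a guard if it stands in a row of smaller index than the robber,
-- in a column at most one apart.  By stepping along its row onto the robber's column a guard stays a guard
-- after every robber move, unless it catches the robber, so the robber is shut out of the guard's row and
-- of every row before it for good.  The two cops guard from rows of opposite parity: while one guards from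
-- row i, the other walks along the snake to row i + 1 and then along that row towards the robber's column,
-- where it becomes a guard one row further.  So every round captures the robber, raises the number of
-- sealed rows (which is at most n), or decreases the chasing cop's distance potential.  Transposing the
-- grid exchanges C_H and C_V and preserves the robber layer, so the same strategy wins on C_V.

module Submission where

open import Defs
open import Data.Nat using (ℕ; zero; suc; _+_; _*_; _∸_; _≤_; _<_; _⊔_; z≤n; s≤s; z<s; _≟_; _<?_; _≤?_)
open import Data.Nat.Properties
open import Data.Nat.Divisibility using (_∣_; divides; ∣-refl; ∣m+n∣m⇒∣n)
open import Data.Bool using (Bool; true; false; not; if_then_else_)
open import Data.Bool.Properties using (not-involutive; ¬-not; not-¬) renaming (_≟_ to _≟ᵇ_)
open import Data.Fin using (Fin; toℕ; fromℕ<; inject₁) renaming (zero to fz; suc to fsuc)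
open import Data.Fin.Properties using (toℕ-injective; toℕ<n; toℕ-fromℕ<; toℕ-inject₁)
open import Data.Product using (Σ; _×_; _,_; proj₁; proj₂; ∃; map; map₂)
import Data.Sum as Sum
open import Data.Sum using (_⊎_; inj₁; inj₂) renaming (map₁ to ⊎-map₁; map₂ to ⊎-map₂)
open import Data.Vec using (head)
open import Function using (_∘_; id)
open import Relation.Nullary using (¬_; Dec; yes; no; contradiction)
open import Relation.Nullary.Decidable using (_×-dec_)
open import Relation.Binary.PropositionalEquality
open import Relation.Binary.Definitions using (tri<; tri≈; tri>)

Improves : (level potential level' potential' : ℕ) → Set
Improves l π l' π' = l < l' ⊎ (l' ≡ l × π' < π)

module _ {P : ℕ → Set} (bound : ℕ) (level potential : ℕ → ℕ)
         (level≤bound : ∀ t → level t ≤ bound)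
         (progress : ∀ t → P t ⊎ Improves (level t) (potential t) (level (suc t)) (potential (suc t))) where

  private
    search : ∀ i j t → bound ∸ level t ≤ i → potential t ≤ j → ∃ P
    search i j t gap≤i pot≤j with progress t
    ... | inj₁ p = t , p
    search (suc i) j t gap≤i pot≤j | inj₂ (inj₁ up) =
      search i (potential (suc t)) (suc t) (≤-pred (≤-trans (∸-monoʳ-< up (level≤bound (suc t))) gap≤i)) ≤-refl
    search zero j t gap≤i pot≤j | inj₂ (inj₁ up) =
      contradiction (≤-trans (∸-monoʳ-< up (level≤bound (suc t))) gap≤i) λ ()
    search i (suc j) t gap≤i pot≤j | inj₂ (inj₂ (same , down)) =
      search i j (suc t) (subst (λ l → bound ∸ l ≤ i) (sym same) gap≤i) (≤-pred (≤-trans down pot≤j))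
    search i zero t gap≤i pot≤j | inj₂ (inj₂ (same , down)) =
      contradiction (≤-trans down pot≤j) λ ()

  progress⇒eventually : ∃ P
  progress⇒eventually = search _ _ 0 ≤-refl ≤-refl

module Positional (G : MultiLayerGraph) (ks : Fin (MultiLayerGraph.τ G) → ℕ) where
  open MultiLayerGraph G
  open Game G ks

  Move : Set
  Move = (cs : CopPos) (r : V) (c : Cop) → Σ V (Step (C (layerOf c)) (cs c))

  positional : CopPos → Move → CopStrategy
  positional start move = record { place = start ; move = λ cs rs → move (head cs) (head rs) }

  after : Move → CopPos → V → CopPos
  after move cs r c = proj₁ (move cs r c)

  positional-wins : (start : CopPos) (move : Move) (bound : ℕ) (level potential : CopPos → V → ℕ) →
    (∀ cs r → level cs r ≤ bound) →
    (∀ cs r r' → Step R r r' → let cs' = after move cs r in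
       (∃ λ c → cs' c ≡ r ⊎ cs' c ≡ r')
       ⊎ Improves (level cs r) (potential cs r) (level cs' r') (potential cs' r')) →
    (ρ : RobberStrategy) → Captured (positional start move) ρ
  positional-wins start move bound level potential level≤bound progress ρ =
    capture (progress⇒eventually bound (λ t → level (cops t) (robber t)) (λ t → potential (cops t) (robber t))
                (λ t → level≤bound (cops t) (robber t))
                (λ t → progress (cops t) (robber t) (robber (suc t)) (proj₂ (RobberStrategy.move ρ _ _))))
    where
      σ = positional start move
      cops = copsAt σ ρ
      robber = robberAt σ ρ
      capture : (∃ λ t → ∃ λ c → cops (suc t) c ≡ robber t ⊎ cops (suc t) c ≡ robber (suc t)) →
                Captured σ ρ
      capture (t , c , inj₁ e) = t , c , inj₂ e
      capture (t , c , inj₂ e) = suc t , c , inj₁ e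

-- Unlike Data.Nat.parity, isEven (suc m) reduces to not (isEven m).
isEven : ℕ → Bool
isEven zero = true
isEven (suc m) = not (isEven m)

isEven-pred : ∀ m {p} → isEven (suc m) ≡ p → isEven m ≡ not p
isEven-pred m e = trans (sym (not-involutive _)) (cong not e)

isEven⇒2∣ : ∀ m → isEven m ≡ true → 2 ∣ m
isEven⇒2∣ zero _ = divides 0 refl
isEven⇒2∣ (suc (suc m)) e with isEven⇒2∣ m (isEven-pred m (isEven-pred (suc m) e))
... | divides q m≡q*2 = divides (suc q) (cong (2 +_) m≡q*2)

2∣⇒isEven : ∀ m → 2 ∣ m → isEven m ≡ true
2∣⇒isEven zero _ = refl
2∣⇒isEven (suc zero) (divides zero ())
2∣⇒isEven (suc zero) (divides (suc q) ())
2∣⇒isEven (suc (suc m)) 2∣m+2 = trans (not-involutive _) (2∣⇒isEven m (∣m+n∣m⇒∣n 2∣m+2 ∣-refl))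

isOdd⇒Odd : ∀ m → isEven m ≡ false → Odd m
isOdd⇒Odd m odd 2∣m with trans (sym (2∣⇒isEven m 2∣m)) odd
... | ()

block-boundary : ∀ i j → suc (i * suc j + j) ≡ suc i * suc j + 0
block-boundary i j = begin
  suc (i * suc j + j)         ≡⟨ sym (+-suc (i * suc j) j) ⟩
  i * suc j + suc j           ≡⟨ +-comm (i * suc j) (suc j) ⟩
  suc j + i * suc j           ≡⟨ sym (+-identityʳ _) ⟩
  suc j + i * suc j + 0       ∎
  where open ≡-Reasoning

turn-at-last-column : ∀ {m} i j → suc j ≡ m → suc (i * m + j) ≡ suc i * m + (m ∸ suc j)
turn-at-last-column i j refl rewrite n∸n≡0 j = block-boundary i j

turn-at-first-column : ∀ {m} i → 0 < m → suc (i * m + (m ∸ 1)) ≡ suc i * m + 0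
turn-at-first-column {suc j} i _ = block-boundary i j

upper-neighbour : ∀ {m} (k : Fin m) → suc (toℕ k) < m → Σ (Fin m) λ k' → toℕ k' ≡ suc (toℕ k)
upper-neighbour k k+1<m = fromℕ< k+1<m , toℕ-fromℕ< k+1<m

lower-neighbour : ∀ {m} (k : Fin m) → 0 < toℕ k → Σ (Fin m) λ k' → suc (toℕ k') ≡ toℕ k
lower-neighbour (fsuc k) _ = inject₁ k , cong suc (toℕ-inject₁ k)

transpose : ∀ {n} → Vert n → Vert n
transpose (a , b) = b , a

module Grid (n : ℕ) where
  V : Set
  V = Vert n

  row col : V → ℕ
  row = toℕ ∘ proj₁
  col = toℕ ∘ proj₂

  private
    variable
      x y r r' : V
      i j k L : ℕ
      p q : Bool

  ≡-by-coords : row x ≡ row y → col x ≡ col y → x ≡ y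
  ≡-by-coords r c = cong₂ _,_ (toℕ-injective r) (toℕ-injective c)

  infix 4 _∼_
  _∼_ : ℕ → ℕ → Set
  i ∼ j = i ≤ suc j × j ≤ suc i

  ∼-refl : i ∼ i
  ∼-refl = n≤1+n _ , n≤1+n _

  ∼-reflexive : i ≡ j → i ∼ j
  ∼-reflexive refl = ∼-refl

  ∼-sym : i ∼ j → j ∼ i
  ∼-sym (i≤ , j≤) = j≤ , i≤

  suc⇒∼ : j ≡ suc i → i ∼ j
  suc⇒∼ refl = m≤n⇒m≤1+n (n≤1+n _) , ≤-refl

  GridStep : V → V → Set
  GridStep r r' = (row r' ≡ row r × col r ∼ col r') ⊎ (col r' ≡ col r × row r ∼ row r')

  GridStep-sym : GridStep r r' → GridStep r' r
  GridStep-sym (inj₁ (e , c)) = inj₁ (sym e , ∼-sym c)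
  GridStep-sym (inj₂ (e , c)) = inj₂ (sym e , ∼-sym c)

  GridStep-transpose : GridStep r r' → GridStep (transpose r) (transpose r')
  GridStep-transpose (inj₁ hor) = inj₂ hor
  GridStep-transpose (inj₂ ver) = inj₁ ver

  robber-edge⇒GridStep : RBase n r r' → GridStep r r'
  robber-edge⇒GridStep (inj₁ (inj₁ (a≡ , b'))) = inj₁ (sym (cong toℕ a≡) , suc⇒∼ b')
  robber-edge⇒GridStep (inj₁ (inj₂ (inj₁ ((b0 , b0') , (a' , _))))) = inj₂ (trans b0' (sym b0) , suc⇒∼ a')
  robber-edge⇒GridStep (inj₁ (inj₂ (inj₂ ((bn , bn') , (a' , _))))) =
    inj₂ (suc-injective (trans bn' (sym bn)) , suc⇒∼ a')
  robber-edge⇒GridStep (inj₂ (inj₁ (b≡ , a'))) = inj₂ (sym (cong toℕ b≡) , suc⇒∼ a')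
  robber-edge⇒GridStep (inj₂ (inj₂ (inj₁ ((a0 , a0') , (b' , _))))) = inj₁ (trans a0' (sym a0) , suc⇒∼ b')
  robber-edge⇒GridStep (inj₂ (inj₂ (inj₂ ((an , an') , (b' , _))))) =
    inj₁ (suc-injective (trans an' (sym an)) , suc⇒∼ b')

  robber-step⇒GridStep : Step (RBase n) r r' → GridStep r r'
  robber-step⇒GridStep (inj₁ refl) = inj₁ (refl , ∼-refl)
  robber-step⇒GridStep (inj₂ (inj₁ e)) = robber-edge⇒GridStep e
  robber-step⇒GridStep (inj₂ (inj₂ e)) = GridStep-sym (robber-edge⇒GridStep e)

  GridStep-col∼ : GridStep r r' → col r ∼ col r'
  GridStep-col∼ (inj₁ (_ , col∼)) = col∼
  GridStep-col∼ (inj₂ (col≡ , _)) = ∼-reflexive (sym col≡)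

  GridStep-row≡ : GridStep r r' → col r' ≢ col r → row r' ≡ row r
  GridStep-row≡ (inj₁ (row≡ , _)) _ = row≡
  GridStep-row≡ (inj₂ (col≡ , _)) col≢ = contradiction col≡ col≢

  Guards : V → V → Set
  Guards x r = row x < row r × col x ∼ col r

  meet-or-guard : row x ≤ row r → col x ≡ col r → x ≡ r ⊎ Guards x r
  meet-or-guard rx≤ cx≡ with m≤n⇒m<n∨m≡n rx≤
  ... | inj₁ rx< = inj₂ (rx< , ∼-reflexive cx≡)
  ... | inj₂ rx≡ = inj₁ (≡-by-coords rx≡ cx≡)

  meet-or-guard-after-step : row x ≤ row r → col x ≡ col r → GridStep r r' → x ≡ r ⊎ x ≡ r' ⊎ Guards x r'
  meet-or-guard-after-step {x} {r} {r'} rx≤ cx≡ step with m≤n⇒m<n∨m≡n rx≤ | step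
  ... | inj₂ rx≡ | _ = inj₁ (≡-by-coords rx≡ cx≡)
  ... | inj₁ rx< | inj₁ (row≡ , col∼) =
    inj₂ (inj₂ (subst (row x <_) (sym row≡) rx< , subst (_∼ col r') (sym cx≡) col∼))
  ... | inj₁ rx< | inj₂ (col≡ , (row≤ , _)) =
    inj₂ (meet-or-guard (≤-pred (≤-trans rx< row≤)) (trans cx≡ (sym col≡)))

  HStep : V → V → Set
  HStep = Step (HBase n)

  step-right : suc (col x) < n → Σ V λ y → HStep x y × row y ≡ row x × col y ≡ suc (col x)
  step-right {a , b} b+1<n with upper-neighbour b b+1<n
  ... | b' , b'≡ = (a , b') , inj₂ (inj₁ (inj₁ (refl , b'≡))) , refl , b'≡

  step-left : 0 < col x → Σ V λ y → HStep x y × row y ≡ row x × suc (col y) ≡ col x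
  step-left {a , b} 0<b with lower-neighbour b 0<b
  ... | b' , b'≡ = (a , b') , inj₂ (inj₂ (inj₁ (refl , sym b'≡))) , refl , b'≡

  Towards : ℕ → ℕ → ℕ → Set
  Towards j i k = (j < i × k ≡ suc j) ⊎ (j ≡ i × k ≡ j) ⊎ (i < j × suc k ≡ j)

  step-towards : (x r : V) → Σ V λ y → HStep x y × row y ≡ row x × Towards (col x) (col r) (col y)
  step-towards x r with <-cmp (col x) (col r)
  ... | tri< x<r _ _ = let y , step , row≡ , col≡ = step-right (≤-<-trans x<r (toℕ<n (proj₂ r)))
                       in y , step , row≡ , inj₁ (x<r , col≡)
  ... | tri≈ _ x≡r _ = x , inj₁ refl , refl , inj₂ (inj₁ (x≡r , refl))
  ... | tri> _ _ r<x = let y , step , row≡ , col≡ = step-left (≤-<-trans z≤n r<x)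
                       in y , step , row≡ , inj₂ (inj₂ (r<x , col≡))

  towards-cases : Towards j i k → k ≡ i ⊎ (suc j < i × k ≡ suc j) ⊎ (suc i < j × suc k ≡ j)
  towards-cases (inj₁ (j<i , k≡)) with m≤n⇒m<n∨m≡n j<i
  ... | inj₁ j+1<i = inj₂ (inj₁ (j+1<i , k≡))
  ... | inj₂ j+1≡i = inj₁ (trans k≡ j+1≡i)
  towards-cases (inj₂ (inj₁ (j≡i , k≡))) = inj₁ (trans k≡ j≡i)
  towards-cases (inj₂ (inj₂ (i<j , k+1≡))) with m≤n⇒m<n∨m≡n i<j
  ... | inj₁ i+1<j = inj₂ (inj₂ (i+1<j , k+1≡))
  ... | inj₂ i+1≡j = inj₁ (suc-injective (trans k+1≡ (sym i+1≡j)))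

  towards-lands : j ∼ i → Towards j i k → k ≡ i
  towards-lands (j≤i+1 , i≤j+1) towards with towards-cases towards
  ... | inj₁ k≡i = k≡i
  ... | inj₂ (inj₁ (j+1<i , _)) = contradiction i≤j+1 (<⇒≱ j+1<i)
  ... | inj₂ (inj₂ (i+1<j , _)) = contradiction j≤i+1 (<⇒≱ i+1<j)

  -- The position of (i , j) on the path C_H, which runs through rows of even index (odd in the
  -- 1-based numbering of Defs) from left to right and through the others from right to left.
  snakeAt : ℕ → ℕ → ℕ
  snakeAt i j = i * n + (if isEven i then j else n ∸ suc j)

  snake : V → ℕ
  snake x = snakeAt (row x) (col x)

  snake-right-in-even-row : ∀ i j → isEven i ≡ true → snakeAt i (suc j) ≡ suc (snakeAt i j)
  snake-right-in-even-row i j even rewrite even = +-suc (i * n) j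

  snake-left-in-odd-row : ∀ i j → isEven i ≡ false → suc j < n → snakeAt i j ≡ suc (snakeAt i (suc j))
  snake-left-in-odd-row i j odd j+1<n rewrite odd =
    trans (cong (i * n +_) (+-∸-assoc 1 j+1<n)) (+-suc (i * n) (n ∸ suc (suc j)))

  snake-down-at-last-column : ∀ i j → isEven i ≡ true → suc j ≡ n → snakeAt (suc i) j ≡ suc (snakeAt i j)
  snake-down-at-last-column i j even j+1≡n rewrite even = sym (turn-at-last-column i j j+1≡n)

  snake-down-at-first-column : ∀ i → isEven i ≡ false → 0 < n → snakeAt (suc i) 0 ≡ suc (snakeAt i 0)
  snake-down-at-first-column i odd 0<n rewrite odd = sym (turn-at-first-column i 0<n)

  last-column : j < n → ¬ (suc j < n) → suc j ≡ n
  last-column j<n ¬j+1<n = ≤-antisym j<n (≮⇒≥ ¬j+1<n)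

  snake-forward : suc (row x) < n →
    Σ V λ y → HStep x y × snake y ≡ suc (snake x) × (row y ≡ row x ⊎ row y ≡ suc (row x))
  snake-forward {a , b} a+1<n with isEven (toℕ a) ≟ᵇ true | suc (toℕ b) <? n | toℕ b ≟ 0
  ... | yes parity | yes b+1<n | _ =
    let b' , b'≡ = upper-neighbour b b+1<n in
    (a , b') , inj₂ (inj₁ (inj₁ (refl , b'≡))) ,
    trans (cong (snakeAt (toℕ a)) b'≡) (snake-right-in-even-row (toℕ a) (toℕ b) parity) , inj₁ refl
  ... | yes parity | no ¬b+1<n | _ =
    let a' , a'≡ = upper-neighbour a a+1<n
        last = last-column (toℕ<n b) ¬b+1<n in
    (a' , b) , inj₂ (inj₁ (inj₂ (inj₂ ((last , last) , a'≡ , isOdd⇒Odd _ (cong not parity))))) ,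
    trans (cong (λ i → snakeAt i (toℕ b)) a'≡) (snake-down-at-last-column (toℕ a) (toℕ b) parity last) ,
    inj₂ a'≡
  ... | no ¬even | _ | no b≢0 =
    let b' , b'≡ = lower-neighbour b (n≢0⇒n>0 b≢0) in
    (a , b') , inj₂ (inj₂ (inj₁ (refl , sym b'≡))) ,
    trans (snake-left-in-odd-row (toℕ a) (toℕ b') (¬-not ¬even) (subst (_< n) (sym b'≡) (toℕ<n b)))
          (cong (suc ∘ snakeAt (toℕ a)) b'≡) ,
    inj₁ refl
  ... | no ¬even | _ | yes b≡0 =
    let a' , a'≡ = upper-neighbour a a+1<n in
    (a' , b) , inj₂ (inj₁ (inj₂ (inj₁ ((b≡0 , b≡0) , a'≡ , isEven⇒2∣ _ (cong not (¬-not ¬even)))))) ,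
    trans (cong₂ snakeAt a'≡ b≡0)
          (trans (snake-down-at-first-column (toℕ a) (¬-not ¬even) (≤-<-trans z≤n (toℕ<n b)))
                 (cong (suc ∘ snakeAt (toℕ a)) (sym b≡0))) ,
    inj₂ a'≡

  snake-backward : 0 < row x →
    Σ V λ y → HStep x y × suc (snake y) ≡ snake x × (row y ≡ row x ⊎ suc (row y) ≡ row x)
  snake-backward {a , b} 0<a with isEven (toℕ a) ≟ᵇ true | suc (toℕ b) <? n | toℕ b ≟ 0
  ... | yes parity | _ | no b≢0 =
    let b' , b'≡ = lower-neighbour b (n≢0⇒n>0 b≢0) in
    (a , b') , inj₂ (inj₂ (inj₁ (refl , sym b'≡))) ,
    trans (sym (snake-right-in-even-row (toℕ a) (toℕ b') parity)) (cong (snakeAt (toℕ a)) b'≡) ,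
    inj₁ refl
  ... | yes parity | _ | yes b≡0 =
    let a' , a'≡ = lower-neighbour a 0<a
        even-a'+1 = trans (cong isEven a'≡) parity in
    (a' , b) , inj₂ (inj₂ (inj₂ (inj₁ ((b≡0 , b≡0) , sym a'≡ , isEven⇒2∣ _ even-a'+1)))) ,
    trans (cong (suc ∘ snakeAt (toℕ a')) b≡0)
          (trans (sym (snake-down-at-first-column (toℕ a') (isEven-pred (toℕ a') even-a'+1)
                                                  (≤-<-trans z≤n (toℕ<n b))))
                 (cong₂ snakeAt a'≡ (sym b≡0))) ,
    inj₂ a'≡
  ... | no ¬even | yes b+1<n | _ =
    let b' , b'≡ = upper-neighbour b b+1<n in
    (a , b') , inj₂ (inj₁ (inj₁ (refl , b'≡))) ,
    trans (cong (suc ∘ snakeAt (toℕ a)) b'≡) (sym (snake-left-in-odd-row (toℕ a) (toℕ b) (¬-not ¬even) b+1<n)) ,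
    inj₁ refl
  ... | no ¬even | no ¬b+1<n | _ =
    let a' , a'≡ = lower-neighbour a 0<a
        last = last-column (toℕ<n b) ¬b+1<n
        odd-a'+1 = trans (cong isEven a'≡) (¬-not ¬even) in
    (a' , b) , inj₂ (inj₂ (inj₂ (inj₂ ((last , last) , sym a'≡ , isOdd⇒Odd _ odd-a'+1)))) ,
    trans (sym (snake-down-at-last-column (toℕ a') (toℕ b) (isEven-pred (toℕ a') odd-a'+1) last))
          (cong (λ i → snakeAt i (toℕ b)) a'≡) ,
    inj₂ a'≡

  -- A cop in column j moving along its row towards column i keeps its direction until it meets the
  -- robber's column, so its distance to the end of the row ahead of it decreases.
  chase : ℕ → ℕ → ℕ
  chase j i with j <? i
  ... | yes _ = n ∸ j
  ... | no _ = j

  chase-< : j < i → chase j i ≡ n ∸ j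
  chase-< {j} {i} j<i with j <? i
  ... | yes _ = refl
  ... | no j≮i = contradiction j<i j≮i

  chase-≮ : ¬ j < i → chase j i ≡ j
  chase-≮ {j} {i} j≮i with j <? i
  ... | yes j<i = contradiction j<i j≮i
  ... | no _ = refl

  chase≤n : ∀ i → j < n → chase j i ≤ n
  chase≤n {j} i j<n with j <? i
  ... | yes _ = m∸n≤m n j
  ... | no _ = <⇒≤ j<n

  closing-in-from-left : row y ≡ row x → row x ≤ row r → col y < col r → col y ≡ suc (col x) →
    GridStep r r' →
    y ≡ r' ⊎ Guards y r' ⊎ chase (col y) (col r') < chase (col x) (col r)
  closing-in-from-left {y} {x} {r} {r'} row≡ rx≤ y<r y≡x+1 step with <-cmp (col y) (col r')
  ... | tri< y<r' _ _ = inj₂ (inj₂ (begin-strict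
        chase (col y) (col r') ≡⟨ chase-< y<r' ⟩
        n ∸ col y               <⟨ ∸-monoʳ-< (≤-reflexive (sym y≡x+1)) (<⇒≤ (toℕ<n (proj₂ y))) ⟩
        n ∸ col x               ≡⟨ chase-< (<-trans (≤-reflexive (sym y≡x+1)) y<r) ⟨
        chase (col x) (col r)   ∎))
    where open ≤-Reasoning
  ... | tri≈ _ y≡r' _ = ⊎-map₂ inj₁ (meet-or-guard row-y≤r' y≡r')
    where
      row-y≤r' : row y ≤ row r'
      row-y≤r' = subst₂ _≤_ (sym row≡) (sym (GridStep-row≡ step λ r'≡r → <⇒≢ y<r (trans y≡r' r'≡r)))
                            rx≤
  ... | tri> _ _ r'<y = contradiction r'<y (≤⇒≯ (≤-pred (≤-trans y<r (proj₁ (GridStep-col∼ step)))))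

  chase-from-right : ∀ {i i' j k} → suc i < j → suc k ≡ j → i ∼ i' → chase k i' < chase j i
  chase-from-right {i} {i'} {j} {k} i+1<j k+1≡j (_ , i'≤i+1) = begin-strict
    chase k i' ≡⟨ chase-≮ (≤⇒≯ (≤-trans i'≤i+1 i+1≤k)) ⟩
    k          <⟨ ≤-reflexive k+1≡j ⟩
    j          ≡⟨ chase-≮ (<⇒≯ (<-trans (n<1+n i) i+1<j)) ⟨
    chase j i  ∎
    where
      open ≤-Reasoning
      i+1≤k : suc i ≤ k
      i+1≤k = ≤-pred (subst (suc (suc i) ≤_) (sym k+1≡j) i+1<j)

  closing-in : row y ≡ row x → row x ≤ row r → Towards (col x) (col r) (col y) → GridStep r r' →
    (y ≡ r ⊎ y ≡ r') ⊎ Guards y r' ⊎ chase (col y) (col r') < chase (col x) (col r)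
  closing-in {y} {x} {r} row≡ rx≤ towards step with towards-cases towards
  ... | inj₁ lands with meet-or-guard-after-step (subst (_≤ row r) (sym row≡) rx≤) lands step
  ...   | inj₁ y≡r = inj₁ (inj₁ y≡r)
  ...   | inj₂ (inj₁ y≡r') = inj₁ (inj₂ y≡r')
  ...   | inj₂ (inj₂ guards) = inj₂ (inj₁ guards)
  closing-in {y} {x} {r} row≡ rx≤ towards step | inj₂ (inj₁ (x+1<r , y≡x+1))
    with closing-in-from-left row≡ rx≤ (subst (_< col r) (sym y≡x+1) x+1<r) y≡x+1 step
  ... | inj₁ y≡r' = inj₁ (inj₂ y≡r')
  ... | inj₂ progress = inj₂ progress
  closing-in row≡ rx≤ towards step | inj₂ (inj₂ (r+1<x , y+1≡x)) =
    inj₂ (inj₂ (chase-from-right r+1<x y+1≡x (GridStep-col∼ step)))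

  Guarding : Bool → V → V → Set
  Guarding p x r = isEven (row x) ≡ p × Guards x r

  guarding? : ∀ p x r → Dec (Guarding p x r)
  guarding? p x r =
    (isEven (row x) ≟ᵇ p) ×-dec (row x <? row r) ×-dec (col x ≤? suc (col r)) ×-dec (col r ≤? suc (col x))

  -- Cop p only counts as a guard on rows of parity p, so the two cops never seal the same positive
  -- number of rows and the roles of guard and chaser are always well defined (guard-seals-frontier).
  opaque
    sealed : Bool → V → V → ℕ
    sealed p x r with guarding? p x r
    ... | yes _ = suc (row x)
    ... | no _ = 0

    sealed-guarding : Guarding p x r → sealed p x r ≡ suc (row x)
    sealed-guarding {p} {x} {r} guarding with guarding? p x r
    ... | yes _ = refl
    ... | no ¬guarding = contradiction guarding ¬guarding

    sealed-cases : ∀ p x r → (Guarding p x r × sealed p x r ≡ suc (row x)) ⊎ sealed p x r ≡ 0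
    sealed-cases p x r with guarding? p x r
    ... | yes guarding = inj₁ (guarding , refl)
    ... | no _ = inj₂ refl

  sealed≤row : ∀ p x r → sealed p x r ≤ row r
  sealed≤row p x r with sealed-cases p x r
  ... | inj₁ ((_ , x<r , _) , s≡) = subst (_≤ row r) (sym s≡) x<r
  ... | inj₂ s≡0 = subst (_≤ row r) (sym s≡0) z≤n

  guard-step : row y ≡ row x → Towards (col x) (col r) (col y) → GridStep r r' →
    y ≡ r' ⊎ sealed p x r ≤ sealed p y r'
  guard-step {y} {x} {r} {r'} {p} row≡ towards step with sealed-cases p x r
  ... | inj₂ s≡0 = inj₂ (subst (_≤ sealed p y r') (sym s≡0) z≤n)
  ... | inj₁ ((parity , x<r , col∼) , s≡)
    with meet-or-guard-after-step (≤-trans (≤-reflexive row≡) (<⇒≤ x<r)) (towards-lands col∼ towards) step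
  ...   | inj₁ y≡r = contradiction (cong row y≡r) (<⇒≢ (subst (_< row r) (sym row≡) x<r))
  ...   | inj₂ (inj₁ y≡r') = inj₁ y≡r'
  ...   | inj₂ (inj₂ guards) = inj₂ (≤-reflexive (begin
          sealed p x r   ≡⟨ s≡ ⟩
          suc (row x)    ≡⟨ cong suc row≡ ⟨
          suc (row y)    ≡⟨ sealed-guarding (trans (cong isEven row≡) parity , guards) ⟨
          sealed p y r'  ∎))
    where open ≡-Reasoning

  snakeAt< : ∀ i → j < n → snakeAt i j < suc i * n
  snakeAt< {j} i j<n = begin-strict
    i * n + (if isEven i then j else n ∸ suc j) <⟨ +-monoʳ-< (i * n) (offset< (isEven i)) ⟩
    i * n + n                                   ≡⟨ +-comm (i * n) n ⟩
    suc i * n                                   ∎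
    where
      open ≤-Reasoning
      offset< : ∀ b → (if b then j else n ∸ suc j) < n
      offset< true = j<n
      offset< false = ∸-monoʳ-< z<s j<n

  snake<row-start : row x < L → snake x < L * n
  snake<row-start {x} x<L = ≤-trans (snakeAt< (row x) (toℕ<n (proj₂ x))) (*-monoˡ-≤ n x<L)

  -- Off the target row L the chaser walks along the snake; the offset suc n puts every such position
  -- above every position on row L.
  gap : ℕ → V → V → ℕ
  gap L x r with <-cmp (row x) L
  ... | tri< _ _ _ = suc n + (L * n ∸ snake x)
  ... | tri≈ _ _ _ = chase (col x) (col r)
  ... | tri> _ _ _ = suc n + snake x

  gap-in-row : row x ≡ L → gap L x r ≡ chase (col x) (col r)
  gap-in-row {x} {L} x≡L with <-cmp (row x) L
  ... | tri< _ x≢L _ = contradiction x≡L x≢L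
  ... | tri≈ _ _ _ = refl
  ... | tri> _ x≢L _ = contradiction x≡L x≢L

  chase<outside : ∀ i k → j < n → chase j i < suc n + k
  chase<outside i k j<n = s≤s (≤-trans (chase≤n i j<n) (m≤m+n n k))

  gap-after-forward : row x < L → row y ≡ row x ⊎ row y ≡ suc (row x) → snake y ≡ suc (snake x) →
    gap L y r < suc n + (L * n ∸ snake x)
  gap-after-forward {x} {L} {y} {r} x<L rows snake≡ with <-cmp (row y) L
  ... | tri< y<L _ _ = +-monoʳ-< (suc n) (∸-monoʳ-< (≤-reflexive (sym snake≡)) (<⇒≤ (snake<row-start y<L)))
  ... | tri≈ _ _ _ = chase<outside (col r) _ (toℕ<n (proj₂ y))
  ... | tri> _ _ L<y = contradiction L<y (≤⇒≯ (row-y≤L rows))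
    where
      row-y≤L : row y ≡ row x ⊎ row y ≡ suc (row x) → row y ≤ L
      row-y≤L (inj₁ y≡x) = ≤-trans (≤-reflexive y≡x) (<⇒≤ x<L)
      row-y≤L (inj₂ y≡x+1) = ≤-trans (≤-reflexive y≡x+1) x<L

  gap-after-backward : L < row x → row y ≡ row x ⊎ suc (row y) ≡ row x → suc (snake y) ≡ snake x →
    gap L y r < suc n + snake x
  gap-after-backward {L} {x} {y} {r} L<x rows snake≡ with <-cmp (row y) L
  ... | tri< y<L _ _ = contradiction y<L (≤⇒≯ (L≤row-y rows))
    where
      L≤row-y : row y ≡ row x ⊎ suc (row y) ≡ row x → L ≤ row y
      L≤row-y (inj₁ y≡x) = ≤-trans (<⇒≤ L<x) (≤-reflexive (sym y≡x))
      L≤row-y (inj₂ y+1≡x) = ≤-pred (≤-trans L<x (≤-reflexive (sym y+1≡x)))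
  ... | tri≈ _ _ _ = chase<outside (col r) _ (toℕ<n (proj₂ y))
  ... | tri> _ _ _ = +-monoʳ-< (suc n) (≤-reflexive snake≡)

  approach : (L : ℕ) → L < n → (x r : V) → Σ V (HStep x)
  approach L L<n x r with <-cmp (row x) L
  ... | tri< x<L _ _ = map₂ proj₁ (snake-forward (≤-<-trans x<L L<n))
  ... | tri≈ _ _ _ = map₂ proj₁ (step-towards x r)
  ... | tri> _ _ L<x = map₂ proj₁ (snake-backward (≤-<-trans z≤n L<x))

  approach-in-row : row x ≡ L → isEven L ≡ q → L ≤ row r → GridStep r r' → let y = proj₁ (step-towards x r) in
    (y ≡ r ⊎ y ≡ r') ⊎ sealed q y r' ≡ suc L ⊎ gap L y r' < chase (col x) (col r)
  approach-in-row {x} {L} {q} {r} x≡L parity L≤r step with step-towards x r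
  ... | y , _ , row≡ , towards
    with closing-in row≡ (subst (_≤ row r) (sym x≡L) L≤r) towards step | trans row≡ x≡L
  ...   | inj₁ caught | _ = inj₁ caught
  ...   | inj₂ (inj₁ guards) | y≡L =
    inj₂ (inj₁ (trans (sealed-guarding (trans (cong isEven y≡L) parity , guards)) (cong suc y≡L)))
  ...   | inj₂ (inj₂ closer) | y≡L = inj₂ (inj₂ (subst (_< chase (col x) (col r)) (sym (gap-in-row y≡L)) closer))

  ChaseOutcome : ℕ → Bool → V → V → V → V → Set
  ChaseOutcome L q x r y r' = (y ≡ r ⊎ y ≡ r') ⊎ sealed q y r' ≡ suc L ⊎ gap L y r' < gap L x r

  approach-progress : (L<n : L < n) → isEven L ≡ q → L ≤ row r → GridStep r r' →
    ChaseOutcome L q x r (proj₁ (approach L L<n x r)) r'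
  approach-progress {L} {q} {r} {r'} {x} L<n parity L≤r step with <-cmp (row x) L
  ... | tri< x<L _ _ =
    let _ , _ , snake≡ , rows = snake-forward (≤-<-trans x<L L<n) in
    inj₂ (inj₂ (gap-after-forward x<L rows snake≡))
  ... | tri> _ _ L<x =
    let _ , _ , snake≡ , rows = snake-backward (≤-<-trans z≤n L<x) in
    inj₂ (inj₂ (gap-after-backward L<x rows snake≡))
  ... | tri≈ _ x≡L _ = approach-in-row x≡L parity L≤r step

  Cops : Set
  Cops = Bool → V

  frontier : Cops → V → ℕ
  frontier cops r = sealed true (cops true) r ⊔ sealed false (cops false) r

  private
    variable
      cops cops' : Cops

  sealed≤frontier : ∀ cops r p → sealed p (cops p) r ≤ frontier cops r
  sealed≤frontier cops r true = m≤m⊔n _ (sealed false (cops false) r)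
  sealed≤frontier cops r false = m≤n⊔m (sealed true (cops true) r) _

  frontier-attained : ∀ cops r → ∃ λ p → sealed p (cops p) r ≡ frontier cops r
  frontier-attained cops r with ⊔-sel (sealed true (cops true) r) (sealed false (cops false) r)
  ... | inj₁ e = true , sym e
  ... | inj₂ e = false , sym e

  frontier≤row : ∀ cops r → frontier cops r ≤ row r
  frontier≤row cops r = ⊔-lub (sealed≤row true (cops true) r) (sealed≤row false (cops false) r)

  chaser : Cops → V → Bool
  chaser cops r = isEven (frontier cops r)

  guard-seals-frontier : ∀ cops r → let g = not (chaser cops r) in sealed g (cops g) r ≡ frontier cops r
  guard-seals-frontier cops r with frontier-attained cops r
  ... | p , attained with sealed-cases p (cops p) r
  ...   | inj₂ s≡0 =
    ≤-antisym (sealed≤frontier cops r g) (subst (_≤ sealed g (cops g) r) (trans (sym s≡0) attained) z≤n)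
    where g = not (chaser cops r)
  ...   | inj₁ ((parity , _) , s≡) = subst (λ b → sealed b (cops b) r ≡ frontier cops r) (sym guard≡p) attained
    where
      guard≡p : not (chaser cops r) ≡ p
      guard≡p = trans (cong (not ∘ isEven) (trans (sym attained) s≡))
                      (trans (cong not (cong not parity)) (not-involutive p))

  frontier<n : ∀ cops r → frontier cops r < n
  frontier<n cops r = ≤-<-trans (frontier≤row cops r) (toℕ<n (proj₁ r))

  copStep : (cops : Cops) (r : V) (p : Bool) → Σ V (HStep (cops p))
  copStep cops r p with p ≟ᵇ chaser cops r
  ... | yes _ = approach (frontier cops r) (frontier<n cops r) (cops p) r
  ... | no _ = map₂ proj₁ (step-towards (cops p) r)

  copStep-chaser : ∀ cops r → let q = chaser cops r in
    proj₁ (copStep cops r q) ≡ proj₁ (approach (frontier cops r) (frontier<n cops r) (cops q) r)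
  copStep-chaser cops r with chaser cops r ≟ᵇ chaser cops r
  ... | yes _ = refl
  ... | no q≢q = contradiction refl q≢q

  copStep-guard : ∀ cops r → let g = not (chaser cops r) in
    proj₁ (copStep cops r g) ≡ proj₁ (step-towards (cops g) r)
  copStep-guard cops r with not (chaser cops r) ≟ᵇ chaser cops r
  ... | yes g≡q = contradiction g≡q (not-¬ refl ∘ sym)
  ... | no _ = refl

  potential : Cops → V → ℕ
  potential cops r = gap (frontier cops r) (cops (chaser cops r)) r

  Moved : Cops → V → Cops → Set
  Moved cops r cops' = ∀ p → cops' p ≡ proj₁ (copStep cops r p)

  chaser-round : ∀ cops r → Moved cops r cops' → GridStep r r' →
    ChaseOutcome (frontier cops r) (chaser cops r) (cops (chaser cops r)) r (cops' (chaser cops r)) r'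
  chaser-round {cops'} {r'} cops r moved step =
    subst (λ y → ChaseOutcome (frontier cops r) (chaser cops r) (cops (chaser cops r)) r y r')
          (sym (trans (moved (chaser cops r)) (copStep-chaser cops r)))
          (approach-progress {x = cops (chaser cops r)} (frontier<n cops r) refl (frontier≤row cops r) step)

  guard-round : ∀ cops r → Moved cops r cops' → GridStep r r' → let g = not (chaser cops r) in
    cops' g ≡ r' ⊎ frontier cops r ≤ sealed g (cops' g) r'
  guard-round {cops'} {r'} cops r moved step =
    subst (λ z → z ≡ r' ⊎ frontier cops r ≤ sealed g z r') (sym (trans (moved g) (copStep-guard cops r)))
          (subst (λ l → g' ≡ r' ⊎ l ≤ sealed g g' r') (guard-seals-frontier cops r)
                 (guard-step {p = g} row≡ towards step))
    where
      g = not (chaser cops r)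
      g' = proj₁ (step-towards (cops g) r)
      row≡ = proj₁ (proj₂ (proj₂ (step-towards (cops g) r)))
      towards = proj₂ (proj₂ (proj₂ (step-towards (cops g) r)))

  round : ∀ cops r → Moved cops r cops' → GridStep r r' →
    (∃ λ p → cops' p ≡ r ⊎ cops' p ≡ r')
    ⊎ Improves (frontier cops r) (potential cops r) (frontier cops' r') (potential cops' r')
  round {cops'} {r'} cops r moved step with chaser-round cops r moved step | guard-round cops r moved step
  ... | inj₁ (inj₁ caught) | _ = inj₁ (_ , inj₁ caught)
  ... | inj₁ (inj₂ caught) | _ = inj₁ (_ , inj₂ caught)
  ... | inj₂ _ | inj₁ caught = inj₁ (_ , inj₂ caught)
  ... | inj₂ (inj₁ sealed≡) | inj₂ _ =
    inj₂ (inj₁ (≤-trans (≤-reflexive (sym sealed≡)) (sealed≤frontier cops' r' _)))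
  ... | inj₂ (inj₂ closer) | inj₂ F≤ with m≤n⇒m<n∨m≡n (≤-trans F≤ (sealed≤frontier cops' r' _))
  ...   | inj₁ F<F' = inj₂ (inj₁ F<F')
  ...   | inj₂ F≡F' =
    inj₂ (inj₂ (sym F≡F' , subst (λ l → gap l (cops' (isEven l)) r' < potential cops r) F≡F' closer))

module _ (n : ℕ) where
  open Grid n
  open Positional (G² n)

  module HGame = Game (G² n) (alloc 2 0)

  hCop : Bool → HGame.Cop
  hCop true = fz , fz
  hCop false = fz , fsuc fz

  hMove : Move (alloc 2 0)
  hMove cs r (fz , fz) = copStep (cs ∘ hCop) r true
  hMove cs r (fz , fsuc fz) = copStep (cs ∘ hCop) r false
  hMove cs r (fsuc fz , ())

  cops-win-on-C_H : Vert n → HGame.CopsWin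
  cops-win-on-C_H origin = positional (alloc 2 0) (λ _ → origin) hMove ,
    positional-wins (alloc 2 0) (λ _ → origin) hMove n
      (λ cs → frontier (cs ∘ hCop)) (λ cs → potential (cs ∘ hCop))
      (λ cs r → <⇒≤ (frontier<n (cs ∘ hCop) r))
      (λ cs r r' step → ⊎-map₁ (map hCop id)
        (round (cs ∘ hCop) r (λ { true → refl ; false → refl }) (robber-step⇒GridStep step)))

  HStep-transpose : ∀ {x y} → HStep (transpose x) y → Step (VBase n) x (transpose y)
  HStep-transpose (inj₁ refl) = inj₁ refl
  HStep-transpose (inj₂ edge) = inj₂ edge

  module VGame = Game (G² n) (alloc 0 2)

  vCop : Bool → VGame.Cop
  vCop true = fsuc fz , fz
  vCop false = fsuc fz , fsuc fz

  vMove : Move (alloc 0 2)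
  vMove cs r (fz , ())
  vMove cs r (fsuc fz , fz) = map transpose HStep-transpose (copStep (transpose ∘ cs ∘ vCop) (transpose r) true)
  vMove cs r (fsuc fz , fsuc fz) = map transpose HStep-transpose (copStep (transpose ∘ cs ∘ vCop) (transpose r) false)

  cops-win-on-C_V : Vert n → VGame.CopsWin
  cops-win-on-C_V origin = positional (alloc 0 2) (λ _ → origin) vMove ,
    positional-wins (alloc 0 2) (λ _ → origin) vMove n
      (λ cs r → frontier (transpose ∘ cs ∘ vCop) (transpose r))
      (λ cs r → potential (transpose ∘ cs ∘ vCop) (transpose r))
      (λ cs r → <⇒≤ (frontier<n (transpose ∘ cs ∘ vCop) (transpose r)))
      (λ cs r r' step → ⊎-map₁ (map vCop (Sum.map (cong transpose) (cong transpose)))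
        (round (transpose ∘ cs ∘ vCop) (transpose r) (λ { true → refl ; false → refl })
               (GridStep-transpose (robber-step⇒GridStep step))))

lemma3p2 : (n : ℕ) → 1 ≤ n →
    Game.CopsWin (G² n) (alloc 2 0) × Game.CopsWin (G² n) (alloc 0 2)
lemma3p2 n 0<n = cops-win-on-C_H n origin , cops-win-on-C_V n origin
  where origin = fromℕ< 0<n , fromℕ< 0<n
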